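{- Let $T$ be a decomposition tree and $v$ an internal node of $T$ labeled $\oplus$, with left child $v_l$ and right child $v_r$, such that both $v_l$ and $v_r$ have the staircase property. If $\hat\alpha(v_r)>\hat\beta(v_l)$, then $\widehat{\min}(v)=\widehat{\min}(v_l)+\widehat{\min}(v_r)+\hat\alpha(v_r)-\hat\beta(v_l)$.
   Context: All graphs are finite, simple and undirected. For a graph $H$ and $S\subseteq V(H)$, $N_H[S]$ is the closed neighbourhood of $S$ in $H$ and $H[S]$ the induced subgraph; a graph with no vertices is regarded as having a (empty) perfect matching. A decomposition tree is a rooted tree $T$ in which every internal node has exactly two children, a left child $v_l$ and a right child $v_r$, and carries one of the labels $\otimes$ (true twin), $\odot$ (false twin), $\oplus$ (attachment). To each node $v$ are associated a graph $\hat G(v)$ and a twin set $\hat{TS}(v)\subseteq V(\hat G(v))$: for a leaf, $\hat G(v)$ is a single vertex $x$ (distinct leaves giving distinct vertices) and $\hat{TS}(v)=\{x\}$; for an internal node $v$, $V(\hat G(v))=V(\hat G(v_l))\cup V(\hat G(v_r))$ and: if $v$ is labeled $\otimes$, $E(\hat G(v))=E(\hat G(v_l))\cup E(\hat G(v_r))\cup\{xy: x\in \hat{TS}(v_l), y\in\hat{TS}(v_r)\}$ and $\hat{TS}(v)=\hat{TS}(v_l)\cup\hat{TS}(v_r)$; if labeled $\odot$, $E(\hat G(v))=E(\hat G(v_l))\cup E(\hat G(v_r))$ and $\hat{TS}(v)=\hat{TS}(v_l)\cup\hat{TS}(v_r)$; if labeled $\oplus$, the edge set is as for $\otimes$ and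 $\hat{TS}(v)=\hat{TS}(v_l)$. For a node $u$ and $0\le k\le|\hat{TS}(u)|$, $\hat\gamma_k(u)$ is the minimum of $|S|$ over all $S\subseteq V(\hat G(u))$ with $V(\hat G(u))\setminus \hat{TS}(u)\subseteq N_{\hat G(u)}[S]$ for which there is $X\subseteq S\cap\hat{TS}(u)$, $|X|=k$, such that $\hat G(u)[S\setminus X]$ has a perfect matching. Let $\widehat{\min}(u)=\min\{\hat\gamma_k(u):0\le k\le|\hat{TS}(u)|\}$, and let $\hat\alpha(u)$ (resp. $\hat\beta(u)$) be the smallest (resp. largest) $k$ with $\hat\gamma_k(u)=\widehat{\min}(u)$. A node $u$ has the staircase property if for every $0\le k\le|\hat{TS}(u)|$: $\hat\gamma_k(u)=\widehat{\min}(u)+\hat\alpha(u)-k$ if $k\le\hat\alpha(u)$; $\hat\gamma_k(u)=\widehat{\min}(u)+k-\hat\beta(u)$ if $k\ge\hat\beta(u)$; $\hat\gamma_k(u)=\widehat{\min}(u)$ if $\hat\alpha(u)<k<\hat\beta(u)$ and $k-\hat\alpha(u)$ is even; and $\hat\gamma_k(u)=\widehat{\min}(u)+1$ otherwise. -}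

module Defs where

open import Data.Nat using (ℕ; zero; suc; _+_; _∸_; _≤_; _<_; _%_)
open import Data.Bool using (Bool; true; false; _∧_; not)
open import Data.List using (List; []; _∷_; _++_; map)
open import Data.Unit using (⊤)
open import Data.Empty using (⊥)
open import Data.Product using (Σ; _×_; ∃; _,_)
open import Data.Sum using (_⊎_)
open import Relation.Binary.PropositionalEquality using (_≡_)

-- Node labels: ⊗ (true twin), ⊙ (false twin), ⊕ (attachment)
data Label : Set where
  ⊗ ⊙ ⊕ : Label

data DTree : Set where
  leaf : DTree
  node : Label → DTree → DTree → DTree

-- Vertices of Ĝ(t): one per leaf of t (distinct leaves give distinct vertices).
data Vtx : DTree → Set where
  here  : Vtx leaf
  left  : ∀ {o l r} → Vtx l → Vtx (node o l r)
  right : ∀ {o l r} → Vtx r → Vtx (node o l r)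

allV : (t : DTree) → List (Vtx t)
allV leaf = here ∷ []
allV (node o l r) = map left (allV l) ++ map right (allV r)

ts : (t : DTree) → Vtx t → Bool
ts leaf here = true
ts (node ⊗ l r) (left x) = ts l x
ts (node ⊗ l r) (right x) = ts r x
ts (node ⊙ l r) (left x) = ts l x
ts (node ⊙ l r) (right x) = ts r x
ts (node ⊕ l r) (left x) = ts l x
ts (node ⊕ l r) (right x) = false

-- Whether a node label joins the two twin sets completely.
joins : Label → Set
joins ⊗ = ⊤
joins ⊙ = ⊥
joins ⊕ = ⊤

Adj : (t : DTree) → Vtx t → Vtx t → Set
Adj leaf here here = ⊥
Adj (node o l r) (left x) (left y) = Adj l x y
Adj (node o l r) (right x) (right y) = Adj r x y
Adj (node o l r) (left x) (right y) = joins o × (ts l x ≡ true × ts r y ≡ true)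
Adj (node o l r) (right x) (left y) = joins o × (ts r x ≡ true × ts l y ≡ true)

count : {A : Set} → (A → Bool) → List A → ℕ
count P [] = 0
count P (x ∷ xs) with P x
... | true = suc (count P xs)
... | false = count P xs

VSet : DTree → Set
VSet t = Vtx t → Bool

card : (t : DTree) → VSet t → ℕ
card t S = count S (allV t)

tsSize : DTree → ℕ
tsSize t = card t (ts t)

-- Ĝ(t)[W] has a perfect matching: an involution m on W pairing each
-- vertex of W with an adjacent vertex of W (Adj is irreflexive, so this is
-- exactly a set of disjoint edges covering W).
HasPerfectMatching : (t : DTree) → VSet t → Set
HasPerfectMatching t W =
  Σ (Vtx t → Vtx t) λ m →
    ∀ x → W x ≡ true →
      (W (m x) ≡ true) × (Adj t x (m x) × m (m x) ≡ x)

DominatesNonTwins : (t : DTree) → VSet t → Set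
DominatesNonTwins t S =
  ∀ x → ts t x ≡ false → (S x ≡ true) ⊎ (∃ λ y → S y ≡ true × Adj t x y)

Admissible : (t : DTree) → ℕ → VSet t → Set
Admissible t k S =
  DominatesNonTwins t S ×
  Σ (VSet t) λ X →
    (∀ x → X x ≡ true → (S x ≡ true × ts t x ≡ true)) ×
    (card t X ≡ k) ×
    HasPerfectMatching t (λ x → S x ∧ not (X x))

Feasible : DTree → ℕ → ℕ → Set
Feasible t k s = Σ (VSet t) λ S → Admissible t k S × card t S ≡ s

IsGamma : DTree → ℕ → ℕ → Set
IsGamma t k g = Feasible t k g × (∀ s → Feasible t k s → g ≤ s)

IsMin : DTree → ℕ → Set
IsMin t m =
  (Σ ℕ λ k → k ≤ tsSize t × IsGamma t k m) ×
  (∀ k s → k ≤ tsSize t → Feasible t k s → m ≤ s)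

IsAlpha : DTree → ℕ → ℕ → Set
IsAlpha t m a = a ≤ tsSize t × IsGamma t a m × (∀ k → k < a → IsGamma t k m → ⊥)

IsBeta : DTree → ℕ → ℕ → Set
IsBeta t m b =
  b ≤ tsSize t × IsGamma t b m ×
  (∀ k → b < k → k ≤ tsSize t → IsGamma t k m → ⊥)

Staircase : (t : DTree) → (m a b : ℕ) → Set
Staircase t m a b =
  IsMin t m × IsAlpha t m a × IsBeta t m b ×
  (∀ k → k ≤ tsSize t →
     (k ≤ a → IsGamma t k (m + (a ∸ k))) ×
     (b ≤ k → IsGamma t k (m + (k ∸ b))) ×
     (a < k → k < b → (k ∸ a) % 2 ≡ 0 → IsGamma t k m) ×
     (a < k → k < b → (k ∸ a) % 2 ≡ 1 → IsGamma t k (suc m)))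

{-# OPTIONS --safe #-}

{- Let S be a solution at the ⊕-node, with X ⊆ S among the twins of the left child and a perfect
   matching M of S ∖ X.  Edges between the two sides join twins of l to twins of r, and no vertex
   of r is a twin of the node.  Restricting S to l, with the left endpoints of crossing M-edges
   added to X, and to r, with the right endpoints of crossing M-edges as its X, gives solutions
   for γ̂_i(l) and γ̂_j(r) with j ≤ i.  The staircase property bounds their sizes below by
   min̂(l) + (i ∸ β̂(l)) and min̂(r) + (α̂(r) ∸ j), which add up to at least
   min̂(l) + min̂(r) + (α̂(r) ∸ β̂(l)).
   Conversely, for j = max(1, β̂(l)) ≤ α̂(r) the staircase property provides solutions for γ̂_j(l)
   and γ̂_j(r) of exactly these sizes; matching their two X-sets of size j to each other by
   crossing edges yields a solution at the node with k = 0 of the claimed size. -}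

module Submission where

open import Defs
open import Data.Nat using (ℕ; suc; _+_; _∸_; _≤_; _<_; z≤n; s≤s; _⊔_)
open import Data.Nat.Properties
  using ( suc-injective; <-irrefl; <⇒≤; ≰⇒>; _≤?_; ≤-trans; +-assoc; +-identityʳ
        ; +-mono-≤; +-monoˡ-≤; +-monoʳ-≤; ∸-monoˡ-≤; m≤n⇒m∸n≡0; m≤n+o⇒m∸n≤o; m≤n+m∸n
        ; m+[n∸m]≡n; +-∸-comm; m≤m⊔n; m≤n⊔m; ⊔-lub; +-commutativeSemigroup; module ≤-Reasoning )
open import Data.Bool using (Bool; true; false; _∧_; _∨_; not; if_then_else_)
open import Data.Bool.Properties using (_≟_; ∧-identityʳ; ∨-zeroʳ)
open import Data.Fin using (Fin; zero; suc)
open import Data.Fin.Properties using (injective⇒≤)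
open import Data.List using (List; []; _∷_; _++_; map; length; filter; lookup)
open import Data.List.Membership.Propositional using (_∈_)
open import Data.List.Membership.Propositional.Properties
  using (∈-++⁺ˡ; ∈-++⁺ʳ; ∈-map⁺; ∈-map⁻; ∈-filter⁺; ∈-filter⁻; ∈-lookup; ∈-length)
import Data.List.Membership.Setoid.Properties as SetoidMembership
import Data.List.Relation.Unary.All as All
open import Data.List.Relation.Unary.AllPairs using ([]; _∷_)
open import Data.List.Relation.Unary.Any using (here; there; index; tail)
open import Data.List.Relation.Unary.Unique.Propositional using (Unique)
import Data.List.Relation.Unary.Unique.Propositional.Properties as Unique
open import Data.Empty using (⊥-elim)
open import Data.Unit using (tt)
open import Data.Product using (_×_; ∃₂; ∃-syntax; _,_; proj₁; proj₂)
open import Data.Sum using (_⊎_; inj₁; inj₂)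
open import Relation.Binary.Definitions using (DecidableEquality)
open import Relation.Binary.PropositionalEquality
  using (_≡_; refl; sym; trans; cong; cong₂; subst; subst₂; _≗_; setoid; module ≡-Reasoning)
open import Relation.Nullary using (yes; no; ¬_; contradiction)
open import Algebra.Properties.CommutativeSemigroup +-commutativeSemigroup using (interchange)

∧-true⁻ : ∀ a {b} → a ∧ b ≡ true → a ≡ true × b ≡ true
∧-true⁻ true refl = refl , refl

∨-true⁻ : ∀ a {b} → a ∨ b ≡ true → a ≡ true ⊎ b ≡ true
∨-true⁻ true refl = inj₁ refl
∨-true⁻ false b≡true = inj₂ b≡true

∧-not-true⁺ : ∀ {a b} → a ≡ true → b ≡ false → a ∧ not b ≡ true
∧-not-true⁺ refl refl = refl

not-true⁻ : ∀ {a} → not a ≡ true → a ≡ false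
not-true⁻ {false} refl = refl

∸-triangle : ∀ m n o → m ∸ o ≤ (n ∸ o) + (m ∸ n)
∸-triangle m n o = m≤n+o⇒m∸n≤o m o (begin
  m                        ≤⟨ m≤n+m∸n m n ⟩
  n + (m ∸ n)              ≤⟨ +-monoˡ-≤ (m ∸ n) (m≤n+m∸n n o) ⟩
  o + (n ∸ o) + (m ∸ n)    ≡⟨ +-assoc o (n ∸ o) (m ∸ n) ⟩
  o + ((n ∸ o) + (m ∸ n))  ∎)
  where open ≤-Reasoning

∸-split : ∀ {m n o} → o ≤ n → n ≤ m → m ∸ o ≡ (n ∸ o) + (m ∸ n)
∸-split {m} {n} {o} o≤n n≤m = begin
  m ∸ o              ≡⟨ cong (_∸ o) (m+[n∸m]≡n n≤m) ⟨
  (n + (m ∸ n)) ∸ o  ≡⟨ +-∸-comm (m ∸ n) o≤n ⟩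
  (n ∸ o) + (m ∸ n)  ∎
  where open ≡-Reasoning

module _ {A : Set} where

  count-++ : ∀ (P : A → Bool) xs ys → count P (xs ++ ys) ≡ count P xs + count P ys
  count-++ P [] ys = refl
  count-++ P (x ∷ xs) ys with P x
  ... | true = cong suc (count-++ P xs ys)
  ... | false = count-++ P xs ys

  count-map : ∀ {B : Set} (P : B → Bool) (f : A → B) xs → count P (map f xs) ≡ count (λ x → P (f x)) xs
  count-map P f [] = refl
  count-map P f (x ∷ xs) with P (f x)
  ... | true = cong suc (count-map P f xs)
  ... | false = count-map P f xs

  count-false : ∀ (xs : List A) → count (λ _ → false) xs ≡ 0
  count-false [] = refl
  count-false (x ∷ xs) = count-false xs

  count≡length-filter : ∀ (P : A → Bool) xs → count P xs ≡ length (filter (λ x → P x ≟ true) xs)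
  count≡length-filter P [] = refl
  count≡length-filter P (x ∷ xs) with P x
  ... | true = cong suc (count≡length-filter P xs)
  ... | false = count≡length-filter P xs

  lookup-injective : ∀ {xs : List A} → Unique xs → ∀ {i j} → lookup xs i ≡ lookup xs j → i ≡ j
  lookup-injective (_ ∷ _) {zero} {zero} _ = refl
  lookup-injective (x∉xs ∷ _) {zero} {suc j} eq = ⊥-elim (All.lookup x∉xs (∈-lookup j) eq)
  lookup-injective (x∉xs ∷ _) {suc i} {zero} eq = ⊥-elim (All.lookup x∉xs (∈-lookup i) (sym eq))
  lookup-injective (_ ∷ u) {suc i} {suc j} eq = cong suc (lookup-injective u eq)

  length≤-injection : ∀ {B : Set} {xs : List A} {ys : List B} (f : A → B) →
    Unique xs → (∀ {x} → x ∈ xs → f x ∈ ys) →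
    (∀ {x y} → x ∈ xs → y ∈ xs → f x ≡ f y → x ≡ y) → length xs ≤ length ys
  length≤-injection {B} {xs} f uxs f∈ f-inj = injective⇒≤ {f = position} position-injective
    where
      position : Fin (length xs) → Fin _
      position i = index (f∈ (∈-lookup i))
      position-injective : ∀ {i j} → position i ≡ position j → i ≡ j
      position-injective {i} {j} eq = lookup-injective uxs
        (f-inj (∈-lookup i) (∈-lookup j)
          (SetoidMembership.index-injective (setoid B) (f∈ (∈-lookup i)) (f∈ (∈-lookup j)) eq))

partner : ∀ {A B : Set} → DecidableEquality A → B → List A → List B → A → B
partner _≟_ b₀ (x′ ∷ xs) (y ∷ ys) x with x ≟ x′
... | yes _ = y
... | no _ = partner _≟_ b₀ xs ys x
partner _ b₀ _ _ _ = b₀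

module _ {A B : Set} (_≟ᴬ_ : DecidableEquality A) (_≟ᴮ_ : DecidableEquality B) (a₀ : A) (b₀ : B) where

  partner-inverse : ∀ {xs : List A} {ys : List B} {x} → Unique xs → Unique ys → length xs ≡ length ys →
    x ∈ xs → partner _≟ᴬ_ b₀ xs ys x ∈ ys × partner _≟ᴮ_ a₀ ys xs (partner _≟ᴬ_ b₀ xs ys x) ≡ x
  partner-inverse {x′ ∷ xs} {y ∷ ys} {x} (_ ∷ uxs) (y∉ys ∷ uys) len x∈ with x ≟ᴬ x′
  ... | yes refl = here refl , partner-head
    where
      partner-head : partner _≟ᴮ_ a₀ (y ∷ ys) (x ∷ xs) y ≡ x
      partner-head with y ≟ᴮ y
      ... | yes _ = refl
      ... | no y≢y = ⊥-elim (y≢y refl)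
  ... | no x≢x′ = there y′∈ys , partner-tail
    where
      y′ : B
      y′ = partner _≟ᴬ_ b₀ xs ys x
      ih : y′ ∈ ys × partner _≟ᴮ_ a₀ ys xs y′ ≡ x
      ih = partner-inverse uxs uys (suc-injective len) (tail x≢x′ x∈)
      y′∈ys : y′ ∈ ys
      y′∈ys = proj₁ ih
      partner-tail : partner _≟ᴮ_ a₀ (y ∷ ys) (x′ ∷ xs) y′ ≡ x
      partner-tail with y′ ≟ᴮ y
      ... | yes y′≡y = ⊥-elim (All.lookup y∉ys y′∈ys (sym y′≡y))
      ... | no _ = proj₂ ih

_≟ᵛ_ : ∀ {t} → DecidableEquality (Vtx t)
here ≟ᵛ here = yes refl
left x ≟ᵛ left y with x ≟ᵛ y
... | yes refl = yes refl
... | no x≢y = no λ { refl → x≢y refl }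
left x ≟ᵛ right y = no λ ()
right x ≟ᵛ left y = no λ ()
right x ≟ᵛ right y with x ≟ᵛ y
... | yes refl = yes refl
... | no x≢y = no λ { refl → x≢y refl }

allV-complete : ∀ t (x : Vtx t) → x ∈ allV t
allV-complete leaf here = here refl
allV-complete (node o l r) (left x) = ∈-++⁺ˡ (∈-map⁺ left (allV-complete l x))
allV-complete (node o l r) (right y) = ∈-++⁺ʳ (map left (allV l)) (∈-map⁺ right (allV-complete r y))

allV-unique : ∀ t → Unique (allV t)
allV-unique leaf = All.[] ∷ []
allV-unique (node o l r) =
  Unique.++⁺ (Unique.map⁺ (λ { refl → refl }) (allV-unique l))
             (Unique.map⁺ (λ { refl → refl }) (allV-unique r))
             sides-disjoint
  where
    sides-disjoint : ∀ {v} → ¬ (v ∈ map left (allV l) × v ∈ map right (allV r))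
    sides-disjoint (p , q) with ∈-map⁻ left p | ∈-map⁻ right q
    ... | _ , _ , refl | _ , _ , ()

leftmost : ∀ t → Vtx t
leftmost leaf = here
leftmost (node o l r) = left (leftmost l)

ts-leftmost : ∀ t → ts t (leftmost t) ≡ true
ts-leftmost leaf = refl
ts-leftmost (node ⊗ l r) = ts-leftmost l
ts-leftmost (node ⊙ l r) = ts-leftmost l
ts-leftmost (node ⊕ l r) = ts-leftmost l

members : (t : DTree) → VSet t → List (Vtx t)
members t P = filter (λ x → P x ≟ true) (allV t)

module _ {t : DTree} (P : VSet t) where

  card≡length-members : card t P ≡ length (members t P)
  card≡length-members = count≡length-filter P (allV t)

  ∈-members⁺ : ∀ {x} → P x ≡ true → x ∈ members t P
  ∈-members⁺ {x} = ∈-filter⁺ (λ x → P x ≟ true) (allV-complete t x)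

  ∈-members⁻ : ∀ {x} → x ∈ members t P → P x ≡ true
  ∈-members⁻ x∈ = proj₂ (∈-filter⁻ (λ x → P x ≟ true) {xs = allV t} x∈)

  members-unique : Unique (members t P)
  members-unique = Unique.filter⁺ (λ x → P x ≟ true) (allV-unique t)

card-node : ∀ o l r (P : VSet (node o l r)) →
  card (node o l r) P ≡ card l (λ x → P (left x)) + card r (λ y → P (right y))
card-node o l r P = trans (count-++ P (map left (allV l)) (map right (allV r)))
  (cong₂ _+_ (count-map P left (allV l)) (count-map P right (allV r)))

card-∅ : ∀ t → card t (λ _ → false) ≡ 0
card-∅ t = count-false (allV t)

card≤-injection : ∀ {s t} {P : VSet s} {Q : VSet t} (f : Vtx s → Vtx t) →
  (∀ x → P x ≡ true → Q (f x) ≡ true) →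
  (∀ x y → P x ≡ true → P y ≡ true → f x ≡ f y → x ≡ y) → card s P ≤ card t Q
card≤-injection {P = P} {Q} f f-maps f-inj =
  subst₂ _≤_ (sym (card≡length-members P)) (sym (card≡length-members Q))
    (length≤-injection f (members-unique P)
      (λ x∈ → ∈-members⁺ Q (f-maps _ (∈-members⁻ P x∈)))
      (λ x∈ y∈ → f-inj _ _ (∈-members⁻ P x∈) (∈-members⁻ P y∈)))

card-mono : ∀ {t} {P Q : VSet t} → (∀ x → P x ≡ true → Q x ≡ true) → card t P ≤ card t Q
card-mono P⊆Q = card≤-injection (λ x → x) P⊆Q (λ _ _ _ _ eq → eq)

witness⇒card-pos : ∀ {t} (P : VSet t) {x} → P x ≡ true → 0 < card t P
witness⇒card-pos P Px = subst (0 <_) (sym (card≡length-members P)) (∈-length (∈-members⁺ P Px))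

card-pos⇒witness : ∀ {t} (P : VSet t) → 0 < card t P → ∃[ x ] P x ≡ true
card-pos⇒witness {t} P pos with members t P | card≡length-members P | ∈-members⁻ P
... | [] | card≡0 | _ = ⊥-elim (<-irrefl refl (subst (0 <_) card≡0 pos))
... | x ∷ _ | _ | ∈⇒P = x , ∈⇒P (here refl)

record Pairing {s t : DTree} (P : VSet s) (Q : VSet t) : Set where
  field
    to      : Vtx s → Vtx t
    from    : Vtx t → Vtx s
    to-∈    : ∀ x → P x ≡ true → Q (to x) ≡ true
    from-∈  : ∀ y → Q y ≡ true → P (from y) ≡ true
    from∘to : ∀ x → P x ≡ true → from (to x) ≡ x
    to∘from : ∀ y → Q y ≡ true → to (from y) ≡ y

card≡⇒pairing : ∀ {s t} (P : VSet s) (Q : VSet t) → card s P ≡ card t Q → Pairing P Q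
card≡⇒pairing {s} {t} P Q card-eq = record
  { to = to ; from = from
  ; to-∈ = λ x Px → ∈-members⁻ Q (proj₁ (forth x Px))
  ; from-∈ = λ y Qy → ∈-members⁻ P (proj₁ (back y Qy))
  ; from∘to = λ x Px → proj₂ (forth x Px)
  ; to∘from = λ y Qy → proj₂ (back y Qy)
  }
  where
    length-eq : length (members s P) ≡ length (members t Q)
    length-eq = trans (sym (card≡length-members P)) (trans card-eq (card≡length-members Q))
    to : Vtx s → Vtx t
    to = partner _≟ᵛ_ (leftmost t) (members s P) (members t Q)
    from : Vtx t → Vtx s
    from = partner _≟ᵛ_ (leftmost s) (members t Q) (members s P)
    forth : ∀ x → P x ≡ true → to x ∈ members t Q × from (to x) ≡ x
    forth x Px = partner-inverse _≟ᵛ_ _≟ᵛ_ (leftmost s) (leftmost t)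
      (members-unique P) (members-unique Q) length-eq (∈-members⁺ P Px)
    back : ∀ y → Q y ≡ true → from y ∈ members s P × to (from y) ≡ y
    back y Qy = partner-inverse _≟ᵛ_ _≟ᵛ_ (leftmost t) (leftmost s)
      (members-unique Q) (members-unique P) (sym length-eq) (∈-members⁺ Q Qy)

IsPerfectMatching : (t : DTree) → VSet t → (Vtx t → Vtx t) → Set
IsPerfectMatching t W m = ∀ x → W x ≡ true → W (m x) ≡ true × (Adj t x (m x) × m (m x) ≡ x)

IsPerfectMatching-resp : ∀ {t} {W W′ : VSet t} {m} → W ≗ W′ →
  IsPerfectMatching t W m → IsPerfectMatching t W′ m
IsPerfectMatching-resp W≗W′ pm x W′x with pm x (trans (W≗W′ x) W′x)
... | Wmx , adj , mmx = trans (sym (W≗W′ _)) Wmx , adj , mmx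

module _ {o : Label} {l r : DTree} where

  isRight : Vtx (node o l r) → Bool
  isRight (left _) = false
  isRight (right _) = true

  fromLeft : Vtx l → Vtx (node o l r) → Vtx l
  fromLeft _ (left x) = x
  fromLeft d (right _) = d

  fromRight : Vtx r → Vtx (node o l r) → Vtx r
  fromRight d (left _) = d
  fromRight _ (right y) = y

  _⊎ᵛ_ : VSet l → VSet r → VSet (node o l r)
  (P ⊎ᵛ Q) (left x) = P x
  (P ⊎ᵛ Q) (right y) = Q y

  module _ (W : VSet (node o l r)) (m : Vtx (node o l r) → Vtx (node o l r)) where

    matchedWithinˡ matchedAcrossˡ : VSet l
    matchedWithinˡ x = W (left x) ∧ not (isRight (m (left x)))
    matchedAcrossˡ x = W (left x) ∧ isRight (m (left x))

    matchedWithinʳ matchedAcrossʳ : VSet r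
    matchedWithinʳ y = W (right y) ∧ isRight (m (right y))
    matchedAcrossʳ y = W (right y) ∧ not (isRight (m (right y)))

    restrictˡ : Vtx l → Vtx l
    restrictˡ x = fromLeft x (m (left x))

    restrictʳ : Vtx r → Vtx r
    restrictʳ y = fromRight y (m (right y))

  module _ {W : VSet (node o l r)} {m} (pm : IsPerfectMatching (node o l r) W m) where

    restrictˡ-perfect : IsPerfectMatching l (matchedWithinˡ W m) (restrictˡ W m)
    restrictˡ-perfect x within with m (left x) | pm (left x) (proj₁ (∧-true⁻ (W (left x)) within)) | proj₂ (∧-true⁻ (W (left x)) within)
    ... | left z | Wz , adj , mz≡x | _ =
      subst (λ v → W (left z) ∧ not (isRight v) ≡ true) (sym mz≡x) (trans (∧-identityʳ _) Wz) ,
      adj , cong (fromLeft z) mz≡x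
    ... | right _ | _ | ()

    restrictʳ-perfect : IsPerfectMatching r (matchedWithinʳ W m) (restrictʳ W m)
    restrictʳ-perfect y within with m (right y) | pm (right y) (proj₁ (∧-true⁻ (W (right y)) within)) | proj₂ (∧-true⁻ (W (right y)) within)
    ... | right z | Wz , adj , mz≡y | _ =
      subst (λ v → W (right z) ∧ isRight v ≡ true) (sym mz≡y) (trans (∧-identityʳ _) Wz) ,
      adj , cong (fromRight z) mz≡y
    ... | left _ | _ | ()

    matchedAcrossˡ-twin : ∀ x → matchedAcrossˡ W m x ≡ true → ts l x ≡ true
    matchedAcrossˡ-twin x across with m (left x) | pm (left x) (proj₁ (∧-true⁻ (W (left x)) across)) | proj₂ (∧-true⁻ (W (left x)) across)
    ... | right _ | _ , (_ , twin , _) , _ | _ = twin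
    ... | left _ | _ | ()

    matchedAcrossʳ-twin : ∀ y → matchedAcrossʳ W m y ≡ true → ts r y ≡ true
    matchedAcrossʳ-twin y across with m (right y) | pm (right y) (proj₁ (∧-true⁻ (W (right y)) across)) | proj₂ (∧-true⁻ (W (right y)) across)
    ... | left _ | _ , (_ , twin , _) , _ | _ = twin
    ... | right _ | _ | ()

    card-matchedAcross : card r (matchedAcrossʳ W m) ≤ card l (matchedAcrossˡ W m)
    card-matchedAcross = begin
      card r (matchedAcrossʳ W m)                         ≡⟨ cong (_+ card r (matchedAcrossʳ W m)) (card-∅ l) ⟨
      card l (λ _ → false) + card r (matchedAcrossʳ W m)  ≡⟨ card-node o l r acrossʳ ⟨
      card (node o l r) acrossʳ                           ≤⟨ card≤-injection m m-flips m-injective ⟩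
      card (node o l r) acrossˡ                           ≡⟨ card-node o l r acrossˡ ⟩
      card l (matchedAcrossˡ W m) + card r (λ _ → false)  ≡⟨ cong (card l (matchedAcrossˡ W m) +_) (card-∅ r) ⟩
      card l (matchedAcrossˡ W m) + 0                     ≡⟨ +-identityʳ _ ⟩
      card l (matchedAcrossˡ W m)                         ∎
      where
        open ≤-Reasoning
        acrossʳ acrossˡ : VSet (node o l r)
        acrossʳ = (λ _ → false) ⊎ᵛ matchedAcrossʳ W m
        acrossˡ = matchedAcrossˡ W m ⊎ᵛ (λ _ → false)
        m-flips : ∀ u → acrossʳ u ≡ true → acrossˡ (m u) ≡ true
        m-flips (right y) across with m (right y) | pm (right y) (proj₁ (∧-true⁻ (W (right y)) across))
                                   | proj₂ (∧-true⁻ (W (right y)) across)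
        ... | left z | Wz , _ , mz≡y | _ =
          subst (λ v → W (left z) ∧ isRight v ≡ true) (sym mz≡y) (trans (∧-identityʳ _) Wz)
        ... | right _ | _ | ()
        involutive : ∀ u → acrossʳ u ≡ true → m (m u) ≡ u
        involutive (right y) across = proj₂ (proj₂ (pm (right y) (proj₁ (∧-true⁻ (W (right y)) across))))
        m-injective : ∀ u v → acrossʳ u ≡ true → acrossʳ v ≡ true → m u ≡ m v → u ≡ v
        m-injective u v acrossu acrossv mu≡mv =
          trans (sym (involutive u acrossu)) (trans (cong m mu≡mv) (involutive v acrossv))

module _ {o : Label} {l r : DTree} (joined : joins o) {Sˡ Xˡ : VSet l} {Sʳ Xʳ : VSet r}
  (Xˡ⊆ : ∀ x → Xˡ x ≡ true → Sˡ x ≡ true × ts l x ≡ true)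
  (Xʳ⊆ : ∀ y → Xʳ y ≡ true → Sʳ y ≡ true × ts r y ≡ true)
  (π : Pairing Xˡ Xʳ) {mˡ mʳ}
  (pmˡ : IsPerfectMatching l (λ x → Sˡ x ∧ not (Xˡ x)) mˡ)
  (pmʳ : IsPerfectMatching r (λ y → Sʳ y ∧ not (Xʳ y)) mʳ) where

  open Pairing π

  glued : Vtx (node o l r) → Vtx (node o l r)
  glued (left x) = if Xˡ x then right (to x) else left (mˡ x)
  glued (right y) = if Xʳ y then left (from y) else right (mʳ y)

  glued-perfect : IsPerfectMatching (node o l r) (Sˡ ⊎ᵛ Sʳ) glued
  glued-perfect (left x) Sx with Xˡ x in Xx
  ... | true = proj₁ (Xʳ⊆ (to x) Xto) , (joined , proj₂ (Xˡ⊆ x Xx) , proj₂ (Xʳ⊆ (to x) Xto)) , back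
    where
      Xto : Xʳ (to x) ≡ true
      Xto = to-∈ x Xx
      back : glued (right (to x)) ≡ left x
      back rewrite Xto = cong left (from∘to x Xx)
  ... | false with pmˡ x (∧-not-true⁺ Sx Xx)
  ... | within , adj , mmx = proj₁ (∧-true⁻ (Sˡ (mˡ x)) within) , adj , back
    where
      back : glued (left (mˡ x)) ≡ left x
      back rewrite not-true⁻ (proj₂ (∧-true⁻ (Sˡ (mˡ x)) within)) = cong left mmx
  glued-perfect (right y) Sy with Xʳ y in Xy
  ... | true = proj₁ (Xˡ⊆ (from y) Xfrom) , (joined , proj₂ (Xʳ⊆ y Xy) , proj₂ (Xˡ⊆ (from y) Xfrom)) , back
    where
      Xfrom : Xˡ (from y) ≡ true
      Xfrom = from-∈ y Xy
      back : glued (left (from y)) ≡ right y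
      back rewrite Xfrom = cong right (to∘from y Xy)
  ... | false with pmʳ y (∧-not-true⁺ Sy Xy)
  ... | within , adj , mmy = proj₁ (∧-true⁻ (Sʳ (mʳ y)) within) , adj , back
    where
      back : glued (right (mʳ y)) ≡ right y
      back rewrite not-true⁻ (proj₂ (∧-true⁻ (Sʳ (mʳ y)) within)) = cong right mmy

module _ {l r : DTree} where

  dominatesˡ : ∀ {S} → DominatesNonTwins (node ⊕ l r) S → DominatesNonTwins l (λ x → S (left x))
  dominatesˡ dom x nontwin with dom (left x) nontwin
  ... | inj₁ Sx = inj₁ Sx
  ... | inj₂ (left z , Sz , adj) = inj₂ (z , Sz , adj)
  ... | inj₂ (right _ , _ , _ , twin , _) = contradiction (trans (sym nontwin) twin) λ ()

  dominatesʳ : ∀ {S} → DominatesNonTwins (node ⊕ l r) S → DominatesNonTwins r (λ y → S (right y))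
  dominatesʳ dom y nontwin with dom (right y) refl
  ... | inj₁ Sy = inj₁ Sy
  ... | inj₂ (right z , Sz , adj) = inj₂ (z , Sz , adj)
  ... | inj₂ (left _ , _ , _ , twin , _) = contradiction (trans (sym nontwin) twin) λ ()

  dominates-⊕ : ∀ {Sˡ Sʳ x} → DominatesNonTwins l Sˡ → DominatesNonTwins r Sʳ →
    Sˡ x ≡ true → ts l x ≡ true → DominatesNonTwins (node ⊕ l r) (Sˡ ⊎ᵛ Sʳ)
  dominates-⊕ domˡ _ _ _ (left z) nontwin with domˡ z nontwin
  ... | inj₁ Sz = inj₁ Sz
  ... | inj₂ (w , Sw , adj) = inj₂ (left w , Sw , adj)
  dominates-⊕ {x = x} _ domʳ Sx twinx (right y) _ with ts r y in twiny
  ... | true = inj₂ (left x , Sx , tt , twiny , twinx)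
  ... | false with domʳ y twiny
  ...   | inj₁ Sy = inj₁ Sy
  ...   | inj₂ (w , Sw , adj) = inj₂ (right w , Sw , adj)

feasible-split-⊕ : ∀ {l r k s} → Feasible (node ⊕ l r) k s →
  ∃₂ λ i j → j ≤ i × ∃₂ λ sˡ sʳ → Feasible l i sˡ × Feasible r j sʳ × sˡ + sʳ ≡ s
feasible-split-⊕ {l} {r} (S , (dom , X , X⊆ , _ , m , pm) , refl) =
  card l Xˡ , card r Xʳ , Xʳ≤Xˡ , card l Sˡ , card r Sʳ ,
  (Sˡ , (dominatesˡ dom , Xˡ , Xˡ⊆ , refl , restrictˡ W m ,
         IsPerfectMatching-resp unmatchedˡ (restrictˡ-perfect pm)) , refl) ,
  (Sʳ , (dominatesʳ dom , Xʳ , Xʳ⊆ , refl , restrictʳ W m ,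
         IsPerfectMatching-resp unmatchedʳ (restrictʳ-perfect pm)) , refl) ,
  sym (card-node ⊕ l r S)
  where
    W : VSet (node ⊕ l r)
    W u = S u ∧ not (X u)
    Sˡ Xˡ : VSet l
    Sˡ x = S (left x)
    Xˡ x = X (left x) ∨ matchedAcrossˡ W m x
    Sʳ Xʳ : VSet r
    Sʳ y = S (right y)
    Xʳ = matchedAcrossʳ W m

    Xʳ≤Xˡ : card r Xʳ ≤ card l Xˡ
    Xʳ≤Xˡ = ≤-trans (card-matchedAcross pm)
      (card-mono λ x across → trans (cong (X (left x) ∨_) across) (∨-zeroʳ _))

    Xˡ⊆ : ∀ x → Xˡ x ≡ true → Sˡ x ≡ true × ts l x ≡ true
    Xˡ⊆ x Xˡx with ∨-true⁻ (X (left x)) Xˡx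
    ... | inj₁ Xx = X⊆ (left x) Xx
    ... | inj₂ across = proj₁ (∧-true⁻ (S (left x)) (proj₁ (∧-true⁻ (W (left x)) across))) ,
                        matchedAcrossˡ-twin pm x across

    Xʳ⊆ : ∀ y → Xʳ y ≡ true → Sʳ y ≡ true × ts r y ≡ true
    Xʳ⊆ y across = proj₁ (∧-true⁻ (S (right y)) (proj₁ (∧-true⁻ (W (right y)) across))) ,
                   matchedAcrossʳ-twin pm y across

    X-right : ∀ y → X (right y) ≡ false
    X-right y with X (right y) in Xy
    ... | true = contradiction (proj₂ (X⊆ (right y) Xy)) λ ()
    ... | false = refl

    unmatchedˡ : matchedWithinˡ W m ≗ λ x → Sˡ x ∧ not (Xˡ x)
    unmatchedˡ x with S (left x) | X (left x)
    ... | true | true = refl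
    ... | true | false = refl
    ... | false | _ = refl

    unmatchedʳ : matchedWithinʳ W m ≗ λ y → Sʳ y ∧ not (Xʳ y)
    unmatchedʳ y rewrite X-right y with S (right y) | isRight (m (right y))
    ... | true | true = refl
    ... | true | false = refl
    ... | false | _ = refl

feasible-glue-⊕ : ∀ {l r j sˡ sʳ} → 0 < j → Feasible l j sˡ → Feasible r j sʳ →
  Feasible (node ⊕ l r) 0 (sˡ + sʳ)
feasible-glue-⊕ {l} {r} 0<j (Sˡ , (domˡ , Xˡ , Xˡ⊆ , refl , mˡ , pmˡ) , refl)
                            (Sʳ , (domʳ , Xʳ , Xʳ⊆ , Xʳ≡Xˡ , mʳ , pmʳ) , refl) =
  Sˡ ⊎ᵛ Sʳ ,
  (dominates-⊕ domˡ domʳ (proj₁ (Xˡ⊆ x Xx)) (proj₂ (Xˡ⊆ x Xx)) ,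
   (λ _ → false) , (λ _ ()) , card-∅ (node ⊕ l r) ,
   glued tt Xˡ⊆ Xʳ⊆ π pmˡ pmʳ ,
   IsPerfectMatching-resp (λ u → sym (∧-identityʳ _)) (glued-perfect tt Xˡ⊆ Xʳ⊆ π pmˡ pmʳ)) ,
  card-node ⊕ l r (Sˡ ⊎ᵛ Sʳ)
  where
    π : Pairing Xˡ Xʳ
    π = card≡⇒pairing Xˡ Xʳ (sym Xʳ≡Xˡ)
    x : Vtx l
    x = proj₁ (card-pos⇒witness Xˡ 0<j)
    Xx : Xˡ x ≡ true
    Xx = proj₂ (card-pos⇒witness Xˡ 0<j)

feasible⇒≤tsSize : ∀ {t k s} → Feasible t k s → k ≤ tsSize t
feasible⇒≤tsSize (_ , (_ , _ , X⊆ , refl , _) , _) = card-mono λ x Xx → proj₂ (X⊆ x Xx)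

module _ {t : DTree} {m α β : ℕ} where

  staircase-feasible-≤α : ∀ {k} → Staircase t m α β → k ≤ α → Feasible t k (m + (α ∸ k))
  staircase-feasible-≤α {k} (_ , (α≤ts , _) , _ , profile) k≤α =
    proj₁ (proj₁ (profile k (≤-trans k≤α α≤ts)) k≤α)

  staircase-feasible-≥β : ∀ {k} → Staircase t m α β → β ≤ k → k ≤ tsSize t → Feasible t k (m + (k ∸ β))
  staircase-feasible-≥β {k} (_ , _ , _ , profile) β≤k k≤ts = proj₁ (proj₁ (proj₂ (profile k k≤ts)) β≤k)

  staircase-bound-α : ∀ {k s} → Staircase t m α β → Feasible t k s → m + (α ∸ k) ≤ s
  staircase-bound-α {k} {s} ((_ , minimal) , _ , _ , profile) F with k ≤? α
  ... | yes k≤α = proj₂ (proj₁ (profile k (feasible⇒≤tsSize F)) k≤α) s F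
  ... | no k≰α rewrite m≤n⇒m∸n≡0 (<⇒≤ (≰⇒> k≰α)) | +-identityʳ m = minimal k s (feasible⇒≤tsSize F) F

  staircase-bound-β : ∀ {k s} → Staircase t m α β → Feasible t k s → m + (k ∸ β) ≤ s
  staircase-bound-β {k} {s} ((_ , minimal) , _ , _ , profile) F with β ≤? k
  ... | yes β≤k = proj₂ (proj₁ (proj₂ (profile k (feasible⇒≤tsSize F))) β≤k) s F
  ... | no β≰k rewrite m≤n⇒m∸n≡0 (<⇒≤ (≰⇒> β≰k)) | +-identityʳ m = minimal k s (feasible⇒≤tsSize F) F

module _ {l r : DTree} {mˡ αˡ βˡ mʳ αʳ βʳ : ℕ} (stairˡ : Staircase l mˡ αˡ βˡ) (stairʳ : Staircase r mʳ αʳ βʳ) where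

  ⊕-lower-bound : ∀ {k s} → Feasible (node ⊕ l r) k s → mˡ + mʳ + (αʳ ∸ βˡ) ≤ s
  ⊕-lower-bound F with feasible-split-⊕ F
  ... | i , j , j≤i , sˡ , sʳ , Fˡ , Fʳ , refl = begin
    mˡ + mʳ + (αʳ ∸ βˡ)                ≤⟨ +-monoʳ-≤ (mˡ + mʳ) αʳ∸βˡ≤ ⟩
    mˡ + mʳ + ((i ∸ βˡ) + (αʳ ∸ j))    ≡⟨ interchange mˡ mʳ (i ∸ βˡ) (αʳ ∸ j) ⟩
    mˡ + (i ∸ βˡ) + (mʳ + (αʳ ∸ j))    ≤⟨ +-mono-≤ (staircase-bound-β stairˡ Fˡ) (staircase-bound-α stairʳ Fʳ) ⟩
    sˡ + sʳ                            ∎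
    where
      open ≤-Reasoning
      αʳ∸βˡ≤ : αʳ ∸ βˡ ≤ (i ∸ βˡ) + (αʳ ∸ j)
      αʳ∸βˡ≤ = ≤-trans (∸-triangle αʳ j βˡ) (+-monoˡ-≤ (αʳ ∸ j) (∸-monoˡ-≤ βˡ j≤i))

  ⊕-upper-bound : βˡ < αʳ → Feasible (node ⊕ l r) 0 (mˡ + mʳ + (αʳ ∸ βˡ))
  ⊕-upper-bound βˡ<αʳ = subst (Feasible (node ⊕ l r) 0) size (feasible-glue-⊕ 0<j Fˡ Fʳ)
    where
      -- j ≥ 1 puts a twin of l into the glued set, where it dominates the twins of r.
      j : ℕ
      j = 1 ⊔ βˡ
      0<j : 0 < j
      0<j = m≤m⊔n 1 βˡ
      Fˡ : Feasible l j (mˡ + (j ∸ βˡ))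
      Fˡ = staircase-feasible-≥β stairˡ (m≤n⊔m 1 βˡ)
             (⊔-lub (witness⇒card-pos (ts l) (ts-leftmost l)) (proj₁ (proj₁ (proj₂ (proj₂ stairˡ)))))
      j≤αʳ : j ≤ αʳ
      j≤αʳ = ⊔-lub (≤-trans (s≤s z≤n) βˡ<αʳ) (<⇒≤ βˡ<αʳ)
      Fʳ : Feasible r j (mʳ + (αʳ ∸ j))
      Fʳ = staircase-feasible-≤α stairʳ j≤αʳ
      size : mˡ + (j ∸ βˡ) + (mʳ + (αʳ ∸ j)) ≡ mˡ + mʳ + (αʳ ∸ βˡ)
      size = trans (interchange mˡ (j ∸ βˡ) mʳ (αʳ ∸ j))
                   (cong (mˡ + mʳ +_) (sym (∸-split (m≤n⊔m 1 βˡ) j≤αʳ)))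

lemma44 : (tl tr : DTree) (ml al bl mr ar br : ℕ) →
    Staircase tl ml al bl → Staircase tr mr ar br →
    bl < ar →
    IsMin (node ⊕ tl tr) (ml + mr + (ar ∸ bl))
lemma44 tl tr ml al bl mr ar br stairˡ stairʳ bl<ar =
  (0 , z≤n , ⊕-upper-bound stairˡ stairʳ bl<ar , λ _ → ⊕-lower-bound stairˡ stairʳ) ,
  (λ _ _ _ → ⊕-lower-bound stairˡ stairʳ)
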